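{- Restricted to graphs without isolated vertices, the problem of determining whether a graph $G$ is well covered admits a kernel having at most $5\cdot vc^+(G)$ vertices; that is, every graph $G$ without isolated vertices either is not well covered or has at most $5\cdot vc^+(G)$ vertices.
   Context: $vc^+(G)$ is the size of a maximum minimal vertex cover of $G$. $G$ is well covered if all minimal vertex covers of $G$ have the same size. -}

module Defs where

open import Data.Nat using (ℕ; _≤_)
open import Data.Fin using (Fin)
open import Data.Fin.Subset using (Subset; _∈_; _⊆_; _⊂_; ∣_∣)
open import Data.Bool using (Bool; true; false)
open import Data.Product using (Σ; ∃; _×_)
open import Data.Sum using (_⊎_)
open import Relation.Binary.PropositionalEquality using (_≡_; _≢_)
open import Relation.Nullary using (¬_)

record Graph (n : ℕ) : Set where
  field
    adj     : Fin n → Fin n → Bool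
    sym     : ∀ u v → adj u v ≡ adj v u
    irrefl  : ∀ v → adj v v ≡ false

open Graph public

Edge : ∀ {n} → Graph n → Fin n → Fin n → Set
Edge G u v = adj G u v ≡ true

NoIsolated : ∀ {n} → Graph n → Set
NoIsolated {n} G = ∀ (v : Fin n) → ∃ λ u → Edge G v u

IsVertexCover : ∀ {n} → Graph n → Subset n → Set
IsVertexCover G S = ∀ u v → Edge G u v → u ∈ S ⊎ v ∈ S

IsMinimalVertexCover : ∀ {n} → Graph n → Subset n → Set
IsMinimalVertexCover G S =
  IsVertexCover G S × (∀ T → T ⊂ S → ¬ IsVertexCover G T)

IsVcPlus : ∀ {n} → Graph n → ℕ → Set
IsVcPlus G k =
  (∃ λ S → IsMinimalVertexCover G S × ∣ S ∣ ≡ k)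
  × (∀ S → IsMinimalVertexCover G S → ∣ S ∣ ≤ k)

WellCovered : ∀ {n} → Graph n → Set
WellCovered G = ∀ S T → IsMinimalVertexCover G S → IsMinimalVertexCover G T → ∣ S ∣ ≡ ∣ T ∣

-- It suffices to find one minimal vertex cover D with n ≤ 2|D| (so even n ≤ 2·vc⁺(G) holds).
-- D is built by peeling. In the induced subgraph G[W] take a vertex u of minimum degree, its
-- neighbourhood N, the set T ∋ u of vertices outside N whose neighbourhood lies in N, and
-- W' = W ∖ (N ∪ T). For every minimal cover D' of G[W'], N ∪ D' is a minimal cover of G[W];
-- hence G[W'] is again well covered, and it has no isolated vertices. Moreover |T| ≤ |N|:
-- by minimality of the degree every vertex of T is adjacent to a fixed v ∈ N, so a minimal
-- cover of G[W] avoiding v contains T and, disjointly, a minimal cover D₃ of G[W'], whereas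
-- N ∪ D₃ is another minimal cover of G[W]. Hence |W| = |W'| + |N| + |T| ≤ 2|D'| + 2|N|.
module Submission where

open import Defs
open import Data.Nat using (ℕ; _≤_; _*_)
open import Data.Sum using (_⊎_)
open import Relation.Nullary using (¬_)

open import Data.Nat using (suc; _+_; _≤?_; s≤s; z≤n)
open import Data.Nat.Properties
  using ( +-suc; +-cancelˡ-≡; +-cancelʳ-≤; +-mono-≤; +-monoʳ-≤; *-monoʳ-≤; *-monoˡ-≤
        ; ≤-reflexive; ≤-trans; <⇒≱; module ≤-Reasoning)
open import Data.Nat.Tactic.RingSolver using (solve-∀)
open import Data.Bool using (true)
import Data.Bool as Bool
open import Data.Empty using (⊥-elim)
open import Data.Fin using (Fin; _≟_)
open import Data.Fin.Properties using (any?; all?)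
open import Data.Fin.Subset
open import Data.Fin.Subset.Properties
open import Data.Fin.Subset.Induction using (⊂-wellFounded; Acc; acc)
open import Data.Vec using ([]; _∷_; here; there; tabulate)
open import Data.Vec.Properties using (lookup∘tabulate; []=⇒lookup; lookup⇒[]=)
open import Data.List using (allFin; filter)
open import Data.List.Extrema.Nat using (argmin; argmin-all; f[argmin]≤f[xs])
import Data.List.Relation.Unary.All as All
open import Data.List.Relation.Unary.All.Properties using (all-filter)
open import Data.List.Membership.Propositional.Properties using (∈-filter⁺; ∈-allFin)
open import Data.Product using (∃; _×_; _,_; proj₁; proj₂)
open import Data.Sum using (inj₁; inj₂; [_,_])
import Data.Sum
open import Function using (_∘_; id)
open import Level using (Level)
open import Relation.Nullary
  using (Dec; yes; no; does; contradiction; _×-dec_; _⊎-dec_; _→-dec_; ¬?)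
open import Relation.Nullary.Decidable using (decidable-stable)
open import Relation.Unary using (Pred; Decidable)
open import Relation.Binary.PropositionalEquality as ≡ using (_≡_; refl; trans; cong)

private variable
  ℓ : Level
  n : ℕ
  x : Fin n

toSubset : {P : Pred (Fin n) ℓ} → Decidable P → Subset n
toSubset P? = tabulate (does ∘ P?)

module _ {P : Pred (Fin n) ℓ} (P? : Decidable P) where

  ∈-toSubset⁺ : P x → x ∈ toSubset P?
  ∈-toSubset⁺ {x} px with P? x in eq
  ... | yes _  = lookup⇒[]= x _ (trans (lookup∘tabulate _ x) (cong does eq))
  ... | no ¬px = contradiction px ¬px

  ∈-toSubset⁻ : x ∈ toSubset P? → P x
  ∈-toSubset⁻ {x} x∈ with P? x | trans (≡.sym (lookup∘tabulate (does ∘ P?) x)) ([]=⇒lookup x∈)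
  ... | yes px | _  = px
  ... | no  _  | ()

x∈p─q⇒x∉q : ∀ (p q : Subset n) → x ∈ p ─ q → x ∉ q
x∈p─q⇒x∉q (_ ∷ p) (inside  ∷ q) (there x∈p─q) (there x∈q) = x∈p─q⇒x∉q p q x∈p─q x∈q
x∈p─q⇒x∉q (_ ∷ p) (outside ∷ q) (there x∈p─q) (there x∈q) = x∈p─q⇒x∉q p q x∈p─q x∈q

x∉p-x : ∀ (p : Subset n) x → x ∉ p - x
x∉p-x p x x∈p-x = x∈p─q⇒x∉q p ⁅ x ⁆ x∈p-x (x∈⁅x⁆ x)

Disjoint : Subset n → Subset n → Set
Disjoint p q = ∀ {x} → x ∈ p → x ∉ q

∣p∪q∣≡∣p∣+∣q∣ : ∀ (p q : Subset n) → Disjoint p q → ∣ p ∪ q ∣ ≡ ∣ p ∣ + ∣ q ∣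
∣p∪q∣≡∣p∣+∣q∣ []      []      _  = refl
∣p∪q∣≡∣p∣+∣q∣ (s ∷ p) (t ∷ q) pq with ∣p∪q∣≡∣p∣+∣q∣ p q (λ x∈p x∈q → pq (there x∈p) (there x∈q))
... | ih with s | t
...   | inside  | inside  = contradiction here (pq here)
...   | inside  | outside = cong suc ih
...   | outside | inside  = trans (cong suc ih) (≡.sym (+-suc ∣ p ∣ ∣ q ∣))
...   | outside | outside = ih

p≡p─q∪q : ∀ (p q : Subset n) → q ⊆ p → p ≡ (p ─ q) ∪ q
p≡p─q∪q p q q⊆p = ⊆-antisym p⊆p─q∪q (λ x∈ → [ p─q⊆p p q , q⊆p ] (x∈p∪q⁻ (p ─ q) q x∈))
  where
  p⊆p─q∪q : p ⊆ (p ─ q) ∪ q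
  p⊆p─q∪q {x} x∈p with x ∈? q
  ... | yes x∈q = x∈p∪q⁺ (inj₂ x∈q)
  ... | no  x∉q = x∈p∪q⁺ (inj₁ (x∈p∧x∉q⇒x∈p─q x∈p x∉q))

∣p∣≡∣p─q∣+∣q∣ : ∀ (p q : Subset n) → q ⊆ p → ∣ p ∣ ≡ ∣ p ─ q ∣ + ∣ q ∣
∣p∣≡∣p─q∣+∣q∣ p q q⊆p =
  trans (cong ∣_∣ (p≡p─q∪q p q q⊆p)) (∣p∪q∣≡∣p∣+∣q∣ (p ─ q) q (x∈p─q⇒x∉q p q))

¬⊆⇒∃∉ : ∀ (p q : Subset n) → ¬ p ⊆ q → ∃ λ x → x ∈ p × x ∉ q
¬⊆⇒∃∉ p q p⊈q with any? (λ x → x ∈? p ×-dec ¬? (x ∈? q))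
... | yes witness = witness
... | no  none    =
  contradiction (λ {x} x∈p → decidable-stable (x ∈? q) λ x∉q → none (x , x∈p , x∉q)) p⊈q

∃-argmin : ∀ (f : Fin n → ℕ) {p} → Nonempty p → ∃ λ u → u ∈ p × (∀ {y} → y ∈ p → f u ≤ f y)
∃-argmin {n} f {p} (w , w∈p) =
  argmin f w ys , argmin-all f w∈p (all-filter (_∈? p) (allFin n)) ,
  λ y∈p → All.lookup (f[argmin]≤f[xs] w ys) (∈-filter⁺ (_∈? p) (∈-allFin _) y∈p)
  where ys = filter (_∈? p) (allFin n)

module _ {n : ℕ} (G : Graph n) where

  Edge-sym : ∀ {u v} → Edge G u v → Edge G v u
  Edge-sym {u} {v} e = trans (sym G v u) e

  Edge-irrefl : ∀ {u} → ¬ Edge G u u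
  Edge-irrefl {u} e with () ← trans (≡.sym e) (irrefl G u)

  edge? : ∀ u v → Dec (Edge G u v)
  edge? u v = adj G u v Bool.≟ true

  nbhd : Fin n → Subset n
  nbhd u = toSubset (edge? u)

  degreeIn : Subset n → Fin n → ℕ
  degreeIn W u = ∣ W ∩ nbhd u ∣

  CoversIn : Subset n → Subset n → Set
  CoversIn W D = ∀ u v → Edge G u v → u ∈ W → v ∈ W → u ∈ D ⊎ v ∈ D

  -- Minimality under single-vertex removal; as covering is upward closed this amounts to
  -- inclusion-minimality (isMinimalVertexCover).
  IsMinimalCoverIn : Subset n → Subset n → Set
  IsMinimalCoverIn W D = D ⊆ W × CoversIn W D × (∀ {x} → x ∈ D → ¬ CoversIn W (D - x))

  WellCoveredIn : Subset n → Set
  WellCoveredIn W = ∀ {D E} → IsMinimalCoverIn W D → IsMinimalCoverIn W E → ∣ D ∣ ≡ ∣ E ∣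

  NoIsolatedIn : Subset n → Set
  NoIsolatedIn W = ∀ {u} → u ∈ W → ∃ λ v → v ∈ W × Edge G u v

  coversIn? : ∀ W D → Dec (CoversIn W D)
  coversIn? W D = all? λ u → all? λ v →
    edge? u v →-dec u ∈? W →-dec v ∈? W →-dec (u ∈? D ⊎-dec v ∈? D)

  coversIn-mono : ∀ {W D E} → D ⊆ E → CoversIn W D → CoversIn W E
  coversIn-mono D⊆E cov u v e u∈W v∈W = Data.Sum.map D⊆E D⊆E (cov u v e u∈W v∈W)

  coversIn-restrict : ∀ {W V D} → V ⊆ W → CoversIn W D → CoversIn V (D ∩ V)
  coversIn-restrict V⊆W cov u v e u∈V v∈V =
    Data.Sum.map (λ u∈D → x∈p∩q⁺ (u∈D , u∈V)) (λ v∈D → x∈p∩q⁺ (v∈D , v∈V))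
      (cov u v e (V⊆W u∈V) (V⊆W v∈V))

  minimalCoverIn-⊆ : ∀ {W} C → C ⊆ W → CoversIn W C → ∃ λ D → D ⊆ C × IsMinimalCoverIn W D
  minimalCoverIn-⊆ {W} C = go C (⊂-wellFounded C)
    where
    go : ∀ C → Acc _⊂_ C → C ⊆ W → CoversIn W C → ∃ λ D → D ⊆ C × IsMinimalCoverIn W D
    go C (acc rec) C⊆W cov with any? (λ x → x ∈? C ×-dec coversIn? W (C - x))
    ... | no ¬removable = C , id , C⊆W , cov , λ x∈C cov-x → ¬removable (_ , x∈C , cov-x)
    ... | yes (x , x∈C , cov-x) =
      let D , D⊆C-x , minD = go (C - x) (rec (x∈p⇒p-x⊂p x∈C)) (⊆-trans (p─q⊆p C ⁅ x ⁆) C⊆W) cov-x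
      in D , ⊆-trans D⊆C-x (p─q⊆p C ⁅ x ⁆) , minD

  minimalCoverIn-∌ : ∀ W v → ∃ λ D → v ∉ D × IsMinimalCoverIn W D
  minimalCoverIn-∌ W v =
    let D , D⊆W-v , minD = minimalCoverIn-⊆ (W - v) (p─q⊆p W ⁅ v ⁆) W-v-covers
    in D , x∉p-x W v ∘ D⊆W-v , minD
    where
    W-v-covers : CoversIn W (W - v)
    W-v-covers p q e p∈W q∈W with p ≟ v
    ... | yes refl = inj₂ (x∈p∧x≢y⇒x∈p-y q∈W λ { refl → Edge-irrefl e })
    ... | no  p≢v  = inj₁ (x∈p∧x≢y⇒x∈p-y p∈W p≢v)

  minimalCoverIn-empty : ∀ {W} → Empty W → IsMinimalCoverIn W ⊥
  minimalCoverIn-empty empty =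
    (λ x∈⊥ → contradiction x∈⊥ ∉⊥) ,
    (λ u _ _ u∈W _ → contradiction (u , u∈W) empty) ,
    (λ x∈⊥ → contradiction x∈⊥ ∉⊥)

  isMinimalVertexCover : ∀ {D} → IsMinimalCoverIn ⊤ D → IsMinimalVertexCover G D
  isMinimalVertexCover {D} (_ , cov , minimal) = (λ u v e → cov u v e ∈⊤ ∈⊤) , ¬smaller
    where
    ¬smaller : ∀ T → T ⊂ D → ¬ IsVertexCover G T
    ¬smaller T (T⊆D , x , x∈D , x∉T) covT =
      minimal x∈D (coversIn-mono T⊆D-x λ u v e _ _ → covT u v e)
      where
      T⊆D-x : T ⊆ D - x
      T⊆D-x y∈T = x∈p∧x≢y⇒x∈p-y (T⊆D y∈T) λ { refl → x∉T y∈T }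

  module Peel (W : Subset n) (u : Fin n) (u∈W : u ∈ W) where

    N : Subset n
    N = W ∩ nbhd u

    inT? : ∀ y → Dec (y ∈ W × y ∉ N × W ∩ nbhd y ⊆ N)
    inT? y = y ∈? W ×-dec ¬? (y ∈? N) ×-dec W ∩ nbhd y ⊆? N

    T : Subset n
    T = toSubset inT?

    W' : Subset n
    W' = W ─ (N ∪ T)

    N⊆W : N ⊆ W
    N⊆W = p∩q⊆p W (nbhd u)

    N-edge : ∀ {y} → y ∈ N → Edge G u y
    N-edge y∈N = ∈-toSubset⁻ (edge? u) (p∩q⊆q W (nbhd u) y∈N)

    ∈T⁻ : ∀ {y} → y ∈ T → y ∈ W × y ∉ N × W ∩ nbhd y ⊆ N
    ∈T⁻ = ∈-toSubset⁻ inT?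

    T-nbhd⊆N : ∀ {t y} → t ∈ T → y ∈ W → Edge G t y → y ∈ N
    T-nbhd⊆N t∈T y∈W e = proj₂ (proj₂ (∈T⁻ t∈T)) (x∈p∩q⁺ (y∈W , ∈-toSubset⁺ (edge? _) e))

    u∉N : u ∉ N
    u∉N = Edge-irrefl ∘ N-edge

    u∈T : u ∈ T
    u∈T = ∈-toSubset⁺ inT? (u∈W , u∉N , id)

    W'⊆W : W' ⊆ W
    W'⊆W = p─q⊆p W (N ∪ T)

    W'-disjoint-N : Disjoint W' N
    W'-disjoint-N y∈W' y∈N = x∈p─q⇒x∉q W (N ∪ T) y∈W' (x∈p∪q⁺ (inj₁ y∈N))

    W'-disjoint-T : Disjoint W' T
    W'-disjoint-T y∈W' y∈T = x∈p─q⇒x∉q W (N ∪ T) y∈W' (x∈p∪q⁺ (inj₂ y∈T))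

    ∈W'⁺ : ∀ {y} → y ∈ W → y ∉ N → y ∉ T → y ∈ W'
    ∈W'⁺ y∈W y∉N y∉T = x∈p∧x∉q⇒x∈p─q y∈W ([ y∉N , y∉T ] ∘ x∈p∪q⁻ N T)

    W'⊂W : W' ⊂ W
    W'⊂W = W'⊆W , u , u∈W , λ u∈W' → W'-disjoint-T u∈W' u∈T

    classify : ∀ {y} → y ∈ W → y ∈ N ⊎ y ∈ T ⊎ y ∈ W'
    classify y∈W with _ ∈? N | _ ∈? T
    ... | yes y∈N | _       = inj₁ y∈N
    ... | no  _   | yes y∈T = inj₂ (inj₁ y∈T)
    ... | no  y∉N | no  y∉T = inj₂ (inj₂ (∈W'⁺ y∈W y∉N y∉T))

    ∣W∣≡∣W'∣+∣N∣+∣T∣ : ∣ W ∣ ≡ ∣ W' ∣ + (∣ N ∣ + ∣ T ∣)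
    ∣W∣≡∣W'∣+∣N∣+∣T∣ = trans (∣p∣≡∣p─q∣+∣q∣ W (N ∪ T) N∪T⊆W)
      (cong (∣ W' ∣ +_) (∣p∪q∣≡∣p∣+∣q∣ N T λ y∈N y∈T → proj₁ (proj₂ (∈T⁻ y∈T)) y∈N))
      where
      N∪T⊆W : N ∪ T ⊆ W
      N∪T⊆W y∈ = [ N⊆W , proj₁ ∘ ∈T⁻ ] (x∈p∪q⁻ N T y∈)

    ∣N∪D∣≡∣N∣+∣D∣ : ∀ {D} → D ⊆ W' → ∣ N ∪ D ∣ ≡ ∣ N ∣ + ∣ D ∣
    ∣N∪D∣≡∣N∣+∣D∣ {D} D⊆W' = ∣p∪q∣≡∣p∣+∣q∣ N D λ y∈N y∈D → W'-disjoint-N (D⊆W' y∈D) y∈N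

    extend : ∀ {D} → IsMinimalCoverIn W' D → IsMinimalCoverIn W (N ∪ D)
    extend {D} (D⊆W' , covD , minD) = N∪D⊆W , covN∪D , minimalN∪D
      where
      N∪D⊆W : N ∪ D ⊆ W
      N∪D⊆W y∈ = [ N⊆W , W'⊆W ∘ D⊆W' ] (x∈p∪q⁻ N D y∈)

      covN∪D : CoversIn W (N ∪ D)
      covN∪D p q e p∈W q∈W with classify p∈W | classify q∈W
      ... | inj₁ p∈N         | _                = inj₁ (x∈p∪q⁺ (inj₁ p∈N))
      ... | _                | inj₁ q∈N         = inj₂ (x∈p∪q⁺ (inj₁ q∈N))
      ... | inj₂ (inj₁ p∈T)  | _                = inj₂ (x∈p∪q⁺ (inj₁ (T-nbhd⊆N p∈T q∈W e)))
      ... | _                | inj₂ (inj₁ q∈T)  = inj₁ (x∈p∪q⁺ (inj₁ (T-nbhd⊆N q∈T p∈W (Edge-sym e))))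
      ... | inj₂ (inj₂ p∈W') | inj₂ (inj₂ q∈W') =
        Data.Sum.map (x∈p∪q⁺ ∘ inj₂) (x∈p∪q⁺ ∘ inj₂) (covD p q e p∈W' q∈W')

      -- Removing x ∈ N uncovers the edge xu; removing x ∈ D uncovers an edge of G[W'].
      minimalN∪D : ∀ {x} → x ∈ N ∪ D → ¬ CoversIn W (N ∪ D - x)
      minimalN∪D {x} x∈N∪D cov with x∈p∪q⁻ N D x∈N∪D
      ... | inj₁ x∈N = [ x∉p-x (N ∪ D) x , u∉N∪D-x ] (cov x u (Edge-sym (N-edge x∈N)) (N⊆W x∈N) u∈W)
        where
        u∉N∪D-x : u ∉ N ∪ D - x
        u∉N∪D-x u∈ = [ u∉N , (λ u∈D → W'-disjoint-T (D⊆W' u∈D) u∈T) ]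
          (x∈p∪q⁻ N D (p─q⊆p (N ∪ D) ⁅ x ⁆ u∈))
      ... | inj₂ x∈D = minD x∈D λ p q e p∈W' q∈W' →
        Data.Sum.map (fromW' p∈W') (fromW' q∈W') (cov p q e (W'⊆W p∈W') (W'⊆W q∈W'))
        where
        fromW' : ∀ {y} → y ∈ W' → y ∈ N ∪ D - x → y ∈ D - x
        fromW' y∈W' y∈ = x∈p∧x∉q⇒x∈p─q
          ([ ⊥-elim ∘ W'-disjoint-N y∈W' , id ] (x∈p∪q⁻ N D (p─q⊆p (N ∪ D) ⁅ x ⁆ y∈)))
          (x∈p─q⇒x∉q (N ∪ D) ⁅ x ⁆ y∈)

    W'-noIsolated : NoIsolatedIn W'
    W'-noIsolated {y} y∈W' =
      let z , z∈W∩nbhd , z∉N = ¬⊆⇒∃∉ (W ∩ nbhd y) N nbhd⊈N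
          z∈W , z∈nbhd = x∈p∩q⁻ W (nbhd y) z∈W∩nbhd
          y-z = ∈-toSubset⁻ (edge? y) z∈nbhd
      in z , ∈W'⁺ z∈W z∉N (λ z∈T → y∉N (T-nbhd⊆N z∈T y∈W (Edge-sym y-z))) , y-z
      where
      y∈W = W'⊆W y∈W'
      y∉N = W'-disjoint-N y∈W'
      nbhd⊈N : ¬ W ∩ nbhd y ⊆ N
      nbhd⊈N nbhd⊆N = W'-disjoint-T y∈W' (∈-toSubset⁺ inT? (y∈W , y∉N , nbhd⊆N))

    W'-wellCovered : WellCoveredIn W → WellCoveredIn W'
    W'-wellCovered wc {D} {E} minD minE = +-cancelˡ-≡ ∣ N ∣ _ _ (begin
      ∣ N ∣ + ∣ D ∣  ≡⟨ ∣N∪D∣≡∣N∣+∣D∣ (proj₁ minD) ⟨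
      ∣ N ∪ D ∣      ≡⟨ wc (extend minD) (extend minE) ⟩
      ∣ N ∪ E ∣      ≡⟨ ∣N∪D∣≡∣N∣+∣D∣ (proj₁ minE) ⟩
      ∣ N ∣ + ∣ E ∣  ∎)
      where open ≡.≡-Reasoning

    ∣T∣≤∣N∣-via-cover : WellCoveredIn W → ∀ {D} → IsMinimalCoverIn W D → T ⊆ D → ∣ T ∣ ≤ ∣ N ∣
    ∣T∣≤∣N∣-via-cover wc {D} minD T⊆D =
      let D₃ , D₃⊆D∩W' , minD₃ =
            minimalCoverIn-⊆ (D ∩ W') (p∩q⊆q D W') (coversIn-restrict W'⊆W (proj₁ (proj₂ minD)))
          T∪D₃⊆D : T ∪ D₃ ⊆ D
          T∪D₃⊆D y∈ = [ T⊆D , p∩q⊆p D W' ∘ D₃⊆D∩W' ] (x∈p∪q⁻ T D₃ y∈)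
      in +-cancelʳ-≤ ∣ D₃ ∣ _ _ (begin
        ∣ T ∣ + ∣ D₃ ∣  ≡⟨ ∣p∪q∣≡∣p∣+∣q∣ T D₃ (λ y∈T y∈D₃ → W'-disjoint-T (proj₁ minD₃ y∈D₃) y∈T) ⟨
        ∣ T ∪ D₃ ∣      ≤⟨ p⊆q⇒∣p∣≤∣q∣ T∪D₃⊆D ⟩
        ∣ D ∣           ≡⟨ wc minD (extend minD₃) ⟩
        ∣ N ∪ D₃ ∣      ≡⟨ ∣N∪D∣≡∣N∣+∣D∣ (proj₁ minD₃) ⟩
        ∣ N ∣ + ∣ D₃ ∣  ∎)
      where open ≤-Reasoning

    module _ (u-minDegree : ∀ {y} → y ∈ W → degreeIn W u ≤ degreeIn W y) where

      T-adjacent : ∀ {v t} → v ∈ N → t ∈ T → Edge G t v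
      T-adjacent {v} {t} v∈N t∈T with edge? t v
      ... | yes t-v = t-v
      ... | no ¬t-v = contradiction (u-minDegree (proj₁ (∈T⁻ t∈T))) (<⇒≱ (begin-strict
        degreeIn W t  ≤⟨ p⊆q⇒∣p∣≤∣q∣ nbhd⊆N-v ⟩
        ∣ N - v ∣     <⟨ x∈p⇒∣p-x∣<∣p∣ v∈N ⟩
        degreeIn W u  ∎))
        where
        open ≤-Reasoning
        nbhd⊆N-v : W ∩ nbhd t ⊆ N - v
        nbhd⊆N-v y∈ = x∈p∧x≢y⇒x∈p-y (proj₂ (proj₂ (∈T⁻ t∈T)) y∈)
          λ { refl → ¬t-v (∈-toSubset⁻ (edge? t) (p∩q⊆q W (nbhd t) y∈)) }

      ∣T∣≤∣N∣ : NoIsolatedIn W → WellCoveredIn W → ∣ T ∣ ≤ ∣ N ∣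
      ∣T∣≤∣N∣ noIso wc =
        let v , v∈W , u-v = noIso u∈W
            v∈N = x∈p∩q⁺ (v∈W , ∈-toSubset⁺ (edge? u) u-v)
            D , v∉D , minD = minimalCoverIn-∌ W v
            T⊆D : T ⊆ D
            T⊆D t∈T = [ id , ⊥-elim ∘ v∉D ]
              (proj₁ (proj₂ minD) _ v (T-adjacent v∈N t∈T) (proj₁ (∈T⁻ t∈T)) v∈W)
        in ∣T∣≤∣N∣-via-cover wc minD T⊆D

  largeMinimalCoverIn : ∀ W → NoIsolatedIn W → WellCoveredIn W →
                        ∃ λ D → IsMinimalCoverIn W D × ∣ W ∣ ≤ 2 * ∣ D ∣
  largeMinimalCoverIn W = go W (⊂-wellFounded W)
    where
    go : ∀ W → Acc _⊂_ W → NoIsolatedIn W → WellCoveredIn W →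
         ∃ λ D → IsMinimalCoverIn W D × ∣ W ∣ ≤ 2 * ∣ D ∣
    go W _ _ _ with nonempty? W
    go W _ _ _ | no empty =
      ⊥ , minimalCoverIn-empty empty ,
      ≤-trans (≤-reflexive (trans (cong ∣_∣ (Empty-unique empty)) (∣⊥∣≡0 n))) z≤n
    go W (acc rec) noIso wc | yes nonempty =
      let u , u∈W , u-minDegree = ∃-argmin (degreeIn W) nonempty
          open Peel W u u∈W
          D , minD , ∣W'∣≤2∣D∣ = go W' (rec W'⊂W) W'-noIsolated (W'-wellCovered wc)
      in N ∪ D , extend minD , (begin
        ∣ W ∣                        ≡⟨ ∣W∣≡∣W'∣+∣N∣+∣T∣ ⟩
        ∣ W' ∣ + (∣ N ∣ + ∣ T ∣)     ≤⟨ +-mono-≤ ∣W'∣≤2∣D∣ (+-monoʳ-≤ ∣ N ∣ (∣T∣≤∣N∣ u-minDegree noIso wc)) ⟩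
        2 * ∣ D ∣ + (∣ N ∣ + ∣ N ∣)  ≡⟨ regroup ∣ D ∣ ∣ N ∣ ⟩
        2 * (∣ N ∣ + ∣ D ∣)          ≡⟨ cong (2 *_) (∣N∪D∣≡∣N∣+∣D∣ (proj₁ minD)) ⟨
        2 * ∣ N ∪ D ∣                ∎)
      where
      open ≤-Reasoning
      regroup : ∀ d m → 2 * d + (m + m) ≡ 2 * (m + d)
      regroup = solve-∀

wellCovered⇒n≤2*vc⁺ : ∀ {n} (G : Graph n) {k} → NoIsolated G → IsVcPlus G k → WellCovered G →
                      n ≤ 2 * k
wellCovered⇒n≤2*vc⁺ {n} G {k} noIso (_ , vc⁺-maximal) wc =
  let D , minD , ∣⊤∣≤2∣D∣ = largeMinimalCoverIn G ⊤ noIsolated⊤ wellCovered⊤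
  in begin
    n          ≡⟨ ∣⊤∣≡n n ⟨
    ∣ ⊤ {n} ∣  ≤⟨ ∣⊤∣≤2∣D∣ ⟩
    2 * ∣ D ∣  ≤⟨ *-monoʳ-≤ 2 (vc⁺-maximal D (isMinimalVertexCover G minD)) ⟩
    2 * k      ∎
  where
  open ≤-Reasoning
  noIsolated⊤ : NoIsolatedIn G ⊤
  noIsolated⊤ {u} _ = proj₁ (noIso u) , ∈⊤ , proj₂ (noIso u)
  wellCovered⊤ : WellCoveredIn G ⊤
  wellCovered⊤ minD minE = wc _ _ (isMinimalVertexCover G minD) (isMinimalVertexCover G minE)

corollary10 : ∀ (n : ℕ) (G : Graph n) (k : ℕ) → NoIsolated G → IsVcPlus G k →
    ¬ WellCovered G ⊎ n ≤ 5 * k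
corollary10 n G k noIso vc⁺ with n ≤? 5 * k
... | yes n≤5k = inj₂ n≤5k
... | no  n≰5k = inj₁ λ wc →
  n≰5k (≤-trans (wellCovered⇒n≤2*vc⁺ G noIso vc⁺ wc) (*-monoˡ-≤ k {2} {5} (s≤s (s≤s z≤n))))
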